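{- Suppose $\mathcal C$ has pushouts, $P$ is faithful, and either (i) $\rho$ is pointwise epic, or (ii) the mate $\rho^\flat$ is pointwise monic and $T$ preserves monomorphisms. Then every $\rho$-bisimulation is a precocongruence. If, in addition, $T$ preserves weak pullbacks, then $\rho$-bisimilarity coincides with each of the three notions $T$-bisimilarity, (largest) precocongruence, and behavioural equivalence.
   Context: $P\colon\mathcal C\to\mathcal A$, $S\colon\mathcal A\to\mathcal C$ are contravariant functors forming a dual adjunction (natural bijection $\mathcal C(X,SA)\cong\mathcal A(A,PX)$) with units $\eta^{\mathcal C}\colon\mathrm{Id}_{\mathcal C}\to SP$, $\eta^{\mathcal A}\colon\mathrm{Id}_{\mathcal A}\to PS$. $T\colon\mathcal C\to\mathcal C$ is an endofunctor; a $T$-coalgebra is $(X,\gamma)$ with $\gamma\colon X\to TX$, and a coalgebra morphism $f\colon(X,\gamma)\to(X',\gamma')$ satisfies $\gamma'f=Tf\gamma$. $(L,\rho)$ is a logic: $L\colon\mathcal A\to\mathcal A$, $\rho\colon LP\to PT$ natural; complex algebra $\gamma^*=P\gamma\circ\rho_X$. The mate $\rho^\flat\colon TS\to SL$ has components $\rho^\flat_A=S(\rho_{SA}\circ L\eta^{\mathcal A}_A)\circ\eta^{\mathcal C}_{TSA}\colon TSA\to SLA$. Standing assumption: $\mathcal C$ has pullbacks. A span $X_1\xleftarrow{\pi_1}B\xrightarrow{\pi_2}X_2$ is jointly mono if $\pi_1h=\pi_1h'$ and $\pi_2h=\pi_2h'$ imply $h=h'$; its dual span $(\bar B,\bar\pi_1,\bar\pi_2)$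 is the pullback in $\mathcal A$ of $PX_1\xrightarrow{P\pi_1}PB\xleftarrow{P\pi_2}PX_2$; it is a $\rho$-bisimulation between $(X_1,\gamma_1),(X_2,\gamma_2)$ if $P\pi_1\circ\gamma_1^*\circ L\bar\pi_1=P\pi_2\circ\gamma_2^*\circ L\bar\pi_2$. A jointly mono span $(B,\pi_1,\pi_2)$ is: a $T$-bisimulation if there is $t\colon B\to TB$ making $\pi_1,\pi_2$ coalgebra morphisms; a precocongruence if, with $(\hat B,\hat\pi_1,\hat\pi_2)$ the pushout of $\pi_1,\pi_2$, there is $t\colon\hat B\to T\hat B$ with $t\circ\hat\pi_i=T\hat\pi_i\circ\gamma_i$ for $i=1,2$; a behavioural equivalence if it is the pullback in $\mathcal C$ of some cospan of coalgebra morphisms $(X_1,\gamma_1)\to(Y,\delta)\leftarrow(X_2,\gamma_2)$. The associated equivalence notions ($\rho$-bisimilarity, $T$-bisimilarity, etc.) are the joins (largest such relations) of all relations of each kind. -}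

module Defs where

open import Level using (Level; _⊔_) renaming (suc to lsuc)
open import Relation.Binary using (Rel; IsEquivalence)
open import Data.Product using (Σ; _×_; _,_; proj₁; proj₂)
open import Function.Bundles using (_⇔_)

record Category (o ℓ e : Level) : Set (lsuc (o ⊔ ℓ ⊔ e)) where
  infixr 9 _∘_
  infix 4 _≈_
  field
    Obj : Set o
    _⇒_ : Obj → Obj → Set ℓ
    _≈_ : ∀ {X Y} → Rel (X ⇒ Y) e
    id : ∀ {X} → X ⇒ X
    _∘_ : ∀ {X Y Z} → Y ⇒ Z → X ⇒ Y → X ⇒ Z
    equiv : ∀ {X Y} → IsEquivalence (_≈_ {X} {Y})
    ∘-resp-≈ : ∀ {X Y Z} {f h : Y ⇒ Z} {g i : X ⇒ Y} →
               f ≈ h → g ≈ i → f ∘ g ≈ h ∘ i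
    assoc : ∀ {W X Y Z} {f : W ⇒ X} {g : X ⇒ Y} {h : Y ⇒ Z} →
            (h ∘ g) ∘ f ≈ h ∘ (g ∘ f)
    identityˡ : ∀ {X Y} {f : X ⇒ Y} → id ∘ f ≈ f
    identityʳ : ∀ {X Y} {f : X ⇒ Y} → f ∘ id ≈ f

record Functor {o ℓ e o' ℓ' e'} (C : Category o ℓ e) (D : Category o' ℓ' e')
       : Set (o ⊔ ℓ ⊔ e ⊔ o' ⊔ ℓ' ⊔ e') where
  private
    module C = Category C
    module D = Category D
  field
    F₀ : C.Obj → D.Obj
    F₁ : ∀ {X Y} → X C.⇒ Y → F₀ X D.⇒ F₀ Y
    identity : ∀ {X} → F₁ (C.id {X}) D.≈ D.id
    homomorphism : ∀ {X Y Z} {f : X C.⇒ Y} {g : Y C.⇒ Z} →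
                   F₁ (g C.∘ f) D.≈ F₁ g D.∘ F₁ f
    F-resp-≈ : ∀ {X Y} {f g : X C.⇒ Y} → f C.≈ g → F₁ f D.≈ F₁ g

record ContraFunctor {o ℓ e o' ℓ' e'} (C : Category o ℓ e) (D : Category o' ℓ' e')
       : Set (o ⊔ ℓ ⊔ e ⊔ o' ⊔ ℓ' ⊔ e') where
  private
    module C = Category C
    module D = Category D
  field
    F₀ : C.Obj → D.Obj
    F₁ : ∀ {X Y} → X C.⇒ Y → F₀ Y D.⇒ F₀ X
    identity : ∀ {X} → F₁ (C.id {X}) D.≈ D.id
    homomorphism : ∀ {X Y Z} {f : X C.⇒ Y} {g : Y C.⇒ Z} →
                   F₁ (g C.∘ f) D.≈ F₁ f D.∘ F₁ g
    F-resp-≈ : ∀ {X Y} {f g : X C.⇒ Y} → f C.≈ g → F₁ f D.≈ F₁ g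

Endofunctor : ∀ {o ℓ e} → Category o ℓ e → Set (o ⊔ ℓ ⊔ e)
Endofunctor C = Functor C C

module _ {o ℓ e} (C : Category o ℓ e) where
  open Category C

  Mono : ∀ {X Y} → X ⇒ Y → Set (o ⊔ ℓ ⊔ e)
  Mono {X} f = ∀ {W} (g h : W ⇒ X) → f ∘ g ≈ f ∘ h → g ≈ h

  Epi : ∀ {X Y} → X ⇒ Y → Set (o ⊔ ℓ ⊔ e)
  Epi {Y = Y} f = ∀ {Z} (g h : Y ⇒ Z) → g ∘ f ≈ h ∘ f → g ≈ h

  IsPullback : ∀ {Pb X Y Z} (f : X ⇒ Z) (g : Y ⇒ Z) (p₁ : Pb ⇒ X) (p₂ : Pb ⇒ Y)
               → Set (o ⊔ ℓ ⊔ e)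
  IsPullback {Pb} {X} {Y} f g p₁ p₂ =
    (f ∘ p₁ ≈ g ∘ p₂) ×
    (∀ {Q} (q₁ : Q ⇒ X) (q₂ : Q ⇒ Y) → f ∘ q₁ ≈ g ∘ q₂ →
       Σ (Q ⇒ Pb) λ u → (p₁ ∘ u ≈ q₁) × (p₂ ∘ u ≈ q₂) ×
         (∀ (u' : Q ⇒ Pb) → p₁ ∘ u' ≈ q₁ → p₂ ∘ u' ≈ q₂ → u' ≈ u))

  IsWeakPullback : ∀ {Pb X Y Z} (f : X ⇒ Z) (g : Y ⇒ Z) (p₁ : Pb ⇒ X) (p₂ : Pb ⇒ Y)
                   → Set (o ⊔ ℓ ⊔ e)
  IsWeakPullback {Pb} {X} {Y} f g p₁ p₂ =
    (f ∘ p₁ ≈ g ∘ p₂) ×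
    (∀ {Q} (q₁ : Q ⇒ X) (q₂ : Q ⇒ Y) → f ∘ q₁ ≈ g ∘ q₂ →
       Σ (Q ⇒ Pb) λ u → (p₁ ∘ u ≈ q₁) × (p₂ ∘ u ≈ q₂))

  IsPushout : ∀ {Z X Y Po} (f : Z ⇒ X) (g : Z ⇒ Y) (i₁ : X ⇒ Po) (i₂ : Y ⇒ Po)
              → Set (o ⊔ ℓ ⊔ e)
  IsPushout {Z} {X} {Y} {Po} f g i₁ i₂ =
    (i₁ ∘ f ≈ i₂ ∘ g) ×
    (∀ {Q} (q₁ : X ⇒ Q) (q₂ : Y ⇒ Q) → q₁ ∘ f ≈ q₂ ∘ g →
       Σ (Po ⇒ Q) λ u → (u ∘ i₁ ≈ q₁) × (u ∘ i₂ ≈ q₂) ×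
         (∀ (u' : Po ⇒ Q) → u' ∘ i₁ ≈ q₁ → u' ∘ i₂ ≈ q₂ → u' ≈ u))

  record Pullback {X Y Z} (f : X ⇒ Z) (g : Y ⇒ Z) : Set (o ⊔ ℓ ⊔ e) where
    field
      P : Obj
      p₁ : P ⇒ X
      p₂ : P ⇒ Y
      isPullback : IsPullback f g p₁ p₂

  record Pushout {Z X Y} (f : Z ⇒ X) (g : Z ⇒ Y) : Set (o ⊔ ℓ ⊔ e) where
    field
      Q : Obj
      i₁ : X ⇒ Q
      i₂ : Y ⇒ Q
      isPushout : IsPushout f g i₁ i₂

  HasPullbacks : Set (o ⊔ ℓ ⊔ e)
  HasPullbacks = ∀ {X Y Z} (f : X ⇒ Z) (g : Y ⇒ Z) → Pullback f g

  HasPushouts : Set (o ⊔ ℓ ⊔ e)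
  HasPushouts = ∀ {Z X Y} (f : Z ⇒ X) (g : Z ⇒ Y) → Pushout f g

  record Span (X₁ X₂ : Obj) : Set (o ⊔ ℓ) where
    field
      B : Obj
      π₁ : B ⇒ X₁
      π₂ : B ⇒ X₂

  JointlyMono : ∀ {X₁ X₂} → Span X₁ X₂ → Set (o ⊔ ℓ ⊔ e)
  JointlyMono R = ∀ {W} (h h' : W ⇒ B) → π₁ ∘ h ≈ π₁ ∘ h' → π₂ ∘ h ≈ π₂ ∘ h' → h ≈ h'
    where open Span R

  record Relation (X₁ X₂ : Obj) : Set (o ⊔ ℓ ⊔ e) where
    field
      span : Span X₁ X₂
      jointlyMono : JointlyMono span
    open Span span public

  _⊑_ : ∀ {X₁ X₂} → Relation X₁ X₂ → Relation X₁ X₂ → Set (ℓ ⊔ e)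
  R ⊑ R' = Σ (R.B ⇒ R'.B) λ h → (R'.π₁ ∘ h ≈ R.π₁) × (R'.π₂ ∘ h ≈ R.π₂)
    where
      module R = Relation R
      module R' = Relation R'

  IsJoin : ∀ {k X₁ X₂} → (Relation X₁ X₂ → Set k) → Relation X₁ X₂
           → Set (o ⊔ ℓ ⊔ e ⊔ k)
  IsJoin K R = (∀ R' → K R' → R' ⊑ R) ×
               (∀ U → (∀ R' → K R' → R' ⊑ U) → R ⊑ U)

module _ {o ℓ e o' ℓ' e'} {C : Category o ℓ e} {D : Category o' ℓ' e'} where
  private
    module C = Category C
    module D = Category D

  FaithfulContra : ContraFunctor C D → Set (o ⊔ ℓ ⊔ e ⊔ e')
  FaithfulContra F = ∀ {X Y} (f g : X C.⇒ Y) → F₁ f D.≈ F₁ g → f C.≈ g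
    where open ContraFunctor F

module _ {o ℓ e} {C : Category o ℓ e} where
  open Category C

  PreservesMonos : Endofunctor C → Set (o ⊔ ℓ ⊔ e)
  PreservesMonos T = ∀ {X Y} (f : X ⇒ Y) → Mono C f → Mono C (F₁ f)
    where open Functor T

  PreservesWeakPullbacks : Endofunctor C → Set (o ⊔ ℓ ⊔ e)
  PreservesWeakPullbacks T =
    ∀ {Pb X Y Z} (f : X ⇒ Z) (g : Y ⇒ Z) (p₁ : Pb ⇒ X) (p₂ : Pb ⇒ Y) →
    IsWeakPullback C f g p₁ p₂ →
    IsWeakPullback C (F₁ f) (F₁ g) (F₁ p₁) (F₁ p₂)
    where open Functor T

-- Dual adjunction P ⊣ S (contravariant), given by its two units and the
-- triangle identities (equivalent to the natural bijection C(X,SA) ≅ A(A,PX))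

record DualAdjunction {o ℓ e o' ℓ' e'} {C : Category o ℓ e} {A : Category o' ℓ' e'}
       (P : ContraFunctor C A) (S : ContraFunctor A C)
       : Set (o ⊔ ℓ ⊔ e ⊔ o' ⊔ ℓ' ⊔ e') where
  private
    module C = Category C
    module A = Category A
    module P = ContraFunctor P
    module S = ContraFunctor S
  field
    ηC : ∀ X → X C.⇒ S.F₀ (P.F₀ X)
    ηA : ∀ a → a A.⇒ P.F₀ (S.F₀ a)
    ηC-natural : ∀ {X Y} (f : X C.⇒ Y) → ηC Y C.∘ f C.≈ S.F₁ (P.F₁ f) C.∘ ηC X
    ηA-natural : ∀ {a b} (f : a A.⇒ b) → ηA b A.∘ f A.≈ P.F₁ (S.F₁ f) A.∘ ηA a
    triangleP : ∀ X → P.F₁ (ηC X) A.∘ ηA (P.F₀ X) A.≈ A.id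
    triangleS : ∀ a → S.F₁ (ηA a) C.∘ ηC (S.F₀ a) C.≈ C.id

record Logic {o ℓ e o' ℓ' e'} {C : Category o ℓ e} {A : Category o' ℓ' e'}
       (P : ContraFunctor C A) (T : Endofunctor C) (L : Endofunctor A)
       : Set (o ⊔ ℓ ⊔ e ⊔ o' ⊔ ℓ' ⊔ e') where
  private
    module C = Category C
    module A = Category A
    module P = ContraFunctor P
    module T = Functor T
    module L = Functor L
  field
    ρ : ∀ X → L.F₀ (P.F₀ X) A.⇒ P.F₀ (T.F₀ X)
    natural : ∀ {X Y} (f : X C.⇒ Y) →
              ρ X A.∘ L.F₁ (P.F₁ f) A.≈ P.F₁ (T.F₁ f) A.∘ ρ Y

module Theory {o ℓ e o' ℓ' e'}
  (C : Category o ℓ e) (A : Category o' ℓ' e')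
  (P : ContraFunctor C A) (S : ContraFunctor A C)
  (adj : DualAdjunction P S)
  (T : Endofunctor C) (L : Endofunctor A)
  (lg : Logic P T L) where

  private
    module C = Category C
    module A = Category A
    module P = ContraFunctor P
    module S = ContraFunctor S
    module T = Functor T
    module L = Functor L
    module adj = DualAdjunction adj
    module lg = Logic lg

  record Coalgebra : Set (o ⊔ ℓ) where
    field
      X : C.Obj
      γ : X C.⇒ T.F₀ X

  open Coalgebra

  IsCoalgebraMorphism : (c d : Coalgebra) → X c C.⇒ X d → Set e
  IsCoalgebraMorphism c d f = γ d C.∘ f C.≈ T.F₁ f C.∘ γ c

  complex : (c : Coalgebra) → L.F₀ (P.F₀ (X c)) A.⇒ P.F₀ (X c)
  complex c = P.F₁ (γ c) A.∘ lg.ρ (X c)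

  mate : ∀ a → T.F₀ (S.F₀ a) C.⇒ S.F₀ (L.F₀ a)
  mate a = S.F₁ (lg.ρ (S.F₀ a) A.∘ L.F₁ (adj.ηA a)) C.∘ adj.ηC (T.F₀ (S.F₀ a))

  RhoPointwiseEpic : Set (o ⊔ o' ⊔ ℓ' ⊔ e')
  RhoPointwiseEpic = ∀ Y → Epi A (lg.ρ Y)

  MatePointwiseMonic : Set (o ⊔ ℓ ⊔ e ⊔ o')
  MatePointwiseMonic = ∀ a → Mono C (mate a)

  module _ (c₁ c₂ : Coalgebra) where

    Rel₁₂ : Set (o ⊔ ℓ ⊔ e)
    Rel₁₂ = Relation C (X c₁) (X c₂)

    RhoBisimulation : HasPullbacks A → Rel₁₂ → Set e'
    RhoBisimulation pbA R =
      P.F₁ R.π₁ A.∘ complex c₁ A.∘ L.F₁ D.p₁ A.≈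
      P.F₁ R.π₂ A.∘ complex c₂ A.∘ L.F₁ D.p₂
      where
        module R = Relation R
        module D = Pullback (pbA (P.F₁ R.π₁) (P.F₁ R.π₂))

    TBisimulation : Rel₁₂ → Set (ℓ ⊔ e)
    TBisimulation R = Σ (R.B C.⇒ T.F₀ R.B) λ t →
      (γ c₁ C.∘ R.π₁ C.≈ T.F₁ R.π₁ C.∘ t) ×
      (γ c₂ C.∘ R.π₂ C.≈ T.F₁ R.π₂ C.∘ t)
      where module R = Relation R

    Precocongruence : HasPushouts C → Rel₁₂ → Set (ℓ ⊔ e)
    Precocongruence poC R = Σ (Q.Q C.⇒ T.F₀ Q.Q) λ t →
      (t C.∘ Q.i₁ C.≈ T.F₁ Q.i₁ C.∘ γ c₁) ×
      (t C.∘ Q.i₂ C.≈ T.F₁ Q.i₂ C.∘ γ c₂)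
      where
        module R = Relation R
        module Q = Pushout (poC R.π₁ R.π₂)

    BehaviouralEquivalence : Rel₁₂ → Set (o ⊔ ℓ ⊔ e)
    BehaviouralEquivalence R =
      Σ Coalgebra λ d →
      Σ (X c₁ C.⇒ X d) λ f₁ → Σ (X c₂ C.⇒ X d) λ f₂ →
        IsCoalgebraMorphism c₁ d f₁ × IsCoalgebraMorphism c₂ d f₂ ×
        IsPullback C f₁ f₂ R.π₁ R.π₂
      where module R = Relation R

{-# OPTIONS --safe #-}
-- Applying P to the pushout square of R gives a cone over the cospan of the dual span,
-- through which P î₁ and P î₂ factor; the ρ-bisimulation equation then says that the
-- two maps T îᵢ ∘ γᵢ ∘ πᵢ into T of the pushout agree after the transposition
-- h ↦ P h ∘ ρ. This transposition is injective: under (i) because ρ is epic and P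
-- faithful, under (ii) because S (P h ∘ ρ) ∘ η = ρ♭ ∘ T η ∘ h, where ρ♭ is monic and
-- T η is monic as η is (P being faithful). So the two maps agree, and the pushout
-- property yields the precocongruence structure.
--
-- With T preserving weak pullbacks the four classes of relations dominate each other
-- cyclically, hence have the same joins: ρ-bisimulations are precocongruences; a
-- precocongruence lies inside the pullback of its pushout cospan, which is a behavioural
-- equivalence; a behavioural equivalence is a T-bisimulation by the weak pullback
-- property; and a T-bisimulation is a ρ-bisimulation since P turns coalgebra morphisms
-- into morphisms of complex algebras.
module Submission where

open import Level using (_⊔_)
open import Data.Product using (Σ; _×_; _,_; proj₁; proj₂)
open import Data.Sum using (_⊎_; inj₁; inj₂)
open import Function.Bundles using (_⇔_; mk⇔)
open import Relation.Binary.Bundles using (Setoid)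
import Relation.Binary.Reasoning.Setoid as SetoidReasoning

open import Defs

module HomReasoning {o ℓ e} (C : Category o ℓ e) where
  open Category C public

  hom-setoid : ∀ {X Y} → Setoid ℓ e
  hom-setoid {X} {Y} = record { Carrier = X ⇒ Y ; _≈_ = _≈_ ; isEquivalence = equiv }

  module _ {X Y : Obj} where
    open Setoid (hom-setoid {X} {Y}) public using (refl; sym; trans)
    open SetoidReasoning (hom-setoid {X} {Y}) public

  sym-assoc : ∀ {W X Y Z} {f : W ⇒ X} {g : X ⇒ Y} {h : Y ⇒ Z} →
              h ∘ (g ∘ f) ≈ (h ∘ g) ∘ f
  sym-assoc = sym assoc

  infixr 4 _⟩∘⟨_ refl⟩∘⟨_
  infixl 5 _⟩∘⟨refl

  _⟩∘⟨_ : ∀ {X Y Z} {f h : Y ⇒ Z} {g i : X ⇒ Y} → f ≈ h → g ≈ i → f ∘ g ≈ h ∘ i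
  _⟩∘⟨_ = ∘-resp-≈

  refl⟩∘⟨_ : ∀ {X Y Z} {f : Y ⇒ Z} {g i : X ⇒ Y} → g ≈ i → f ∘ g ≈ f ∘ i
  refl⟩∘⟨ q = ∘-resp-≈ refl q

  _⟩∘⟨refl : ∀ {X Y Z} {f h : Y ⇒ Z} {g : X ⇒ Y} → f ≈ h → f ∘ g ≈ h ∘ g
  p ⟩∘⟨refl = ∘-resp-≈ p refl

module _ {o ℓ e} (C : Category o ℓ e) where
  open HomReasoning C

  pullback⇒weakPullback : ∀ {Pb X Y Z} {f : X ⇒ Z} {g : Y ⇒ Z} {p₁ : Pb ⇒ X} {p₂ : Pb ⇒ Y} →
                          IsPullback C f g p₁ p₂ → IsWeakPullback C f g p₁ p₂
  pullback⇒weakPullback (commutes , universal) = commutes , λ q₁ q₂ eq →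
    let (u , u₁ , u₂ , _) = universal q₁ q₂ eq in u , u₁ , u₂

  pullback-jointlyMono : ∀ {Pb X Y Z} {f : X ⇒ Z} {g : Y ⇒ Z} {p₁ : Pb ⇒ X} {p₂ : Pb ⇒ Y} →
                         IsPullback C f g p₁ p₂ →
                         JointlyMono C (record { B = Pb ; π₁ = p₁ ; π₂ = p₂ })
  pullback-jointlyMono {f = f} {g} {p₁} {p₂} (commutes , universal) h h' eq₁ eq₂ =
    let (_ , _ , _ , unique) = universal (p₁ ∘ h) (p₂ ∘ h) commutes-h
    in trans (unique h refl refl) (sym (unique h' (sym eq₁) (sym eq₂)))
    where
      commutes-h : f ∘ (p₁ ∘ h) ≈ g ∘ (p₂ ∘ h)
      commutes-h = trans sym-assoc (trans (commutes ⟩∘⟨refl) assoc)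

  ⊑-refl : ∀ {X₁ X₂} (R : Relation C X₁ X₂) → _⊑_ C R R
  ⊑-refl R = id , identityʳ , identityʳ

  ⊑-trans : ∀ {X₁ X₂} {R R' R'' : Relation C X₁ X₂} →
            _⊑_ C R R' → _⊑_ C R' R'' → _⊑_ C R R''
  ⊑-trans (h , h₁ , h₂) (h' , h'₁ , h'₂) =
    h' ∘ h , trans sym-assoc (trans (h'₁ ⟩∘⟨refl) h₁)
           , trans sym-assoc (trans (h'₂ ⟩∘⟨refl) h₂)

  infix 4 _≼_
  _≼_ : ∀ {k k' X₁ X₂} → (Relation C X₁ X₂ → Set k) → (Relation C X₁ X₂ → Set k') →
        Set (o ⊔ ℓ ⊔ e ⊔ k ⊔ k')
  _≼_ {X₁ = X₁} {X₂} K K' = ∀ R → K R → Σ (Relation C X₁ X₂) λ R' → K' R' × _⊑_ C R R'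

  ⊆⇒≼ : ∀ {k k' X₁ X₂} {K : Relation C X₁ X₂ → Set k} {K' : Relation C X₁ X₂ → Set k'} →
        (∀ R → K R → K' R) → K ≼ K'
  ⊆⇒≼ K⊆K' R k = R , K⊆K' R k , ⊑-refl R

  ≼-trans : ∀ {k k' k'' X₁ X₂} {K : Relation C X₁ X₂ → Set k}
              {K' : Relation C X₁ X₂ → Set k'} {K'' : Relation C X₁ X₂ → Set k''} →
            K ≼ K' → K' ≼ K'' → K ≼ K''
  ≼-trans K≼K' K'≼K'' R k =
    let (R' , k' , R⊑R') = K≼K' R k
        (R'' , k'' , R'⊑R'') = K'≼K'' R' k'
    in R'' , k'' , ⊑-trans {R = R} {R'} {R''} R⊑R' R'⊑R''

  IsJoin-transfer : ∀ {k k' X₁ X₂} {K : Relation C X₁ X₂ → Set k}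
                      {K' : Relation C X₁ X₂ → Set k'} {R : Relation C X₁ X₂} →
                    K ≼ K' → K' ≼ K → IsJoin C K R → IsJoin C K' R
  IsJoin-transfer {R = R} K≼K' K'≼K (upper , least) =
    (λ R' k' → let (R'' , k , R'⊑R'') = K'≼K R' k' in
       ⊑-trans {R = R'} {R''} {R} R'⊑R'' (upper R'' k)) ,
    (λ U upperU → least U λ R' k → let (R'' , k' , R'⊑R'') = K≼K' R' k in
       ⊑-trans {R = R'} {R''} {U} R'⊑R'' (upperU R'' k'))

  IsJoin-resp-≼ : ∀ {k k' X₁ X₂} {K : Relation C X₁ X₂ → Set k}
                    {K' : Relation C X₁ X₂ → Set k'} {R : Relation C X₁ X₂} →
                  K ≼ K' → K' ≼ K → IsJoin C K R ⇔ IsJoin C K' R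
  IsJoin-resp-≼ {R = R} K≼K' K'≼K =
    mk⇔ (IsJoin-transfer {R = R} K≼K' K'≼K) (IsJoin-transfer {R = R} K'≼K K≼K')

module _ {o ℓ e o' ℓ' e'} {C : Category o ℓ e} {A : Category o' ℓ' e'}
         (F : ContraFunctor C A) where
  open ContraFunctor F
  private
    module C = Category C
  open HomReasoning A

  contra-square : ∀ {W X Y Z} {f : Y C.⇒ Z} {g : W C.⇒ Y} {h : X C.⇒ Z} {k : W C.⇒ X} →
                  f C.∘ g C.≈ h C.∘ k → F₁ g ∘ F₁ f ≈ F₁ k ∘ F₁ h
  contra-square {f = f} {g} {h} {k} square = begin
    F₁ g ∘ F₁ f     ≈⟨ homomorphism ⟨
    F₁ (f C.∘ g)    ≈⟨ F-resp-≈ square ⟩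
    F₁ (h C.∘ k)    ≈⟨ homomorphism ⟩
    F₁ k ∘ F₁ h     ∎

module Properties {o ℓ e o' ℓ' e'}
  (C : Category o ℓ e) (A : Category o' ℓ' e')
  (P : ContraFunctor C A) (S : ContraFunctor A C)
  (adj : DualAdjunction P S)
  (T : Endofunctor C) (L : Endofunctor A)
  (lg : Logic P T L) where

  open Theory C A P S adj T L lg
  open Coalgebra
  private
    module C = HomReasoning C
    module A = HomReasoning A
    module P = ContraFunctor P
    module S = ContraFunctor S
    module T = Functor T
    module L = Functor L
    module adj = DualAdjunction adj
  open Logic lg using (ρ)

  faithful⇒ηC-mono : FaithfulContra P → ∀ X → Mono C (adj.ηC X)
  faithful⇒ηC-mono faithful X f g ηf≈ηg = faithful f g (begin
      P.F₁ f                               ≈⟨ split f ⟩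
      P.F₁ (adj.ηC X C.∘ f) ∘ adj.ηA _     ≈⟨ P.F-resp-≈ ηf≈ηg ⟩∘⟨refl ⟩
      P.F₁ (adj.ηC X C.∘ g) ∘ adj.ηA _     ≈⟨ split g ⟨
      P.F₁ g                               ∎)
    where
      open HomReasoning A
      split : ∀ {W} (h : W C.⇒ X) → P.F₁ h ≈ P.F₁ (adj.ηC X C.∘ h) ∘ adj.ηA (P.F₀ X)
      split h = begin
        P.F₁ h                                      ≈⟨ identityʳ ⟨
        P.F₁ h ∘ id                                 ≈⟨ refl⟩∘⟨ adj.triangleP X ⟨
        P.F₁ h ∘ P.F₁ (adj.ηC X) ∘ adj.ηA _         ≈⟨ sym-assoc ⟩
        (P.F₁ h ∘ P.F₁ (adj.ηC X)) ∘ adj.ηA _       ≈⟨ sym P.homomorphism ⟩∘⟨refl ⟩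
        P.F₁ (adj.ηC X C.∘ h) ∘ adj.ηA _            ∎

  ρ-natural-∘ : ∀ {W X Y} (f : X C.⇒ Y) (h : W C.⇒ T.F₀ X) →
                P.F₁ (T.F₁ f C.∘ h) A.∘ ρ Y A.≈ P.F₁ h A.∘ ρ X A.∘ L.F₁ (P.F₁ f)
  ρ-natural-∘ f h = begin
    P.F₁ (T.F₁ f C.∘ h) ∘ ρ _         ≈⟨ P.homomorphism ⟩∘⟨refl ⟩
    (P.F₁ h ∘ P.F₁ (T.F₁ f)) ∘ ρ _    ≈⟨ assoc ⟩
    P.F₁ h ∘ P.F₁ (T.F₁ f) ∘ ρ _      ≈⟨ refl⟩∘⟨ Logic.natural lg f ⟨
    P.F₁ h ∘ ρ _ ∘ L.F₁ (P.F₁ f)      ∎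
    where open HomReasoning A

  ρ-via-units : ∀ {W} Q (h : W C.⇒ T.F₀ Q) →
                P.F₁ (T.F₁ (adj.ηC Q) C.∘ h) A.∘ ρ (S.F₀ (P.F₀ Q)) A.∘ L.F₁ (adj.ηA (P.F₀ Q))
                A.≈ P.F₁ h A.∘ ρ Q
  ρ-via-units Q h = begin
    P.F₁ (T.F₁ (adj.ηC Q) C.∘ h) ∘ ρ _ ∘ L.F₁ (adj.ηA _)
      ≈⟨ sym-assoc ⟩
    (P.F₁ (T.F₁ (adj.ηC Q) C.∘ h) ∘ ρ _) ∘ L.F₁ (adj.ηA _)
      ≈⟨ ρ-natural-∘ (adj.ηC Q) h ⟩∘⟨refl ⟩
    (P.F₁ h ∘ ρ Q ∘ L.F₁ (P.F₁ (adj.ηC Q))) ∘ L.F₁ (adj.ηA _)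
      ≈⟨ trans assoc (refl⟩∘⟨ assoc) ⟩
    P.F₁ h ∘ ρ Q ∘ L.F₁ (P.F₁ (adj.ηC Q)) ∘ L.F₁ (adj.ηA _)
      ≈⟨ refl⟩∘⟨ refl⟩∘⟨ L.homomorphism ⟨
    P.F₁ h ∘ ρ Q ∘ L.F₁ (P.F₁ (adj.ηC Q) ∘ adj.ηA _)
      ≈⟨ refl⟩∘⟨ refl⟩∘⟨ trans (L.F-resp-≈ (adj.triangleP Q)) L.identity ⟩
    P.F₁ h ∘ ρ Q ∘ id
      ≈⟨ refl⟩∘⟨ identityʳ ⟩
    P.F₁ h ∘ ρ Q
      ∎
    where open HomReasoning A

  mate-transpose : ∀ {W} Q (h : W C.⇒ T.F₀ Q) →
                   mate (P.F₀ Q) C.∘ T.F₁ (adj.ηC Q) C.∘ h C.≈ S.F₁ (P.F₁ h A.∘ ρ Q) C.∘ adj.ηC W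
  mate-transpose Q h = begin
    (S.F₁ ρL ∘ adj.ηC _) ∘ T.F₁ (adj.ηC Q) ∘ h
      ≈⟨ assoc ⟩
    S.F₁ ρL ∘ adj.ηC _ ∘ T.F₁ (adj.ηC Q) ∘ h
      ≈⟨ refl⟩∘⟨ adj.ηC-natural (T.F₁ (adj.ηC Q) ∘ h) ⟩
    S.F₁ ρL ∘ S.F₁ (P.F₁ (T.F₁ (adj.ηC Q) ∘ h)) ∘ adj.ηC _
      ≈⟨ trans sym-assoc (sym S.homomorphism ⟩∘⟨refl) ⟩
    S.F₁ (P.F₁ (T.F₁ (adj.ηC Q) ∘ h) A.∘ ρL) ∘ adj.ηC _
      ≈⟨ S.F-resp-≈ (ρ-via-units Q h) ⟩∘⟨refl ⟩
    S.F₁ (P.F₁ h A.∘ ρ Q) ∘ adj.ηC _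
      ∎
    where
      open HomReasoning C
      ρL : L.F₀ (P.F₀ Q) A.⇒ P.F₀ (T.F₀ (S.F₀ (P.F₀ Q)))
      ρL = ρ (S.F₀ (P.F₀ Q)) A.∘ L.F₁ (adj.ηA (P.F₀ Q))

  P-∘ρ-injective : FaithfulContra P → RhoPointwiseEpic ⊎ (MatePointwiseMonic × PreservesMonos T) →
                   ∀ {W Q} (h k : W C.⇒ T.F₀ Q) → P.F₁ h A.∘ ρ Q A.≈ P.F₁ k A.∘ ρ Q → h C.≈ k
  P-∘ρ-injective faithful (inj₁ ρ-epi) h k eq = faithful h k (ρ-epi _ (P.F₁ h) (P.F₁ k) eq)
  P-∘ρ-injective faithful (inj₂ (mate-mono , T-mono)) {Q = Q} h k eq =
    T-mono (adj.ηC Q) (faithful⇒ηC-mono faithful Q) h k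
      (mate-mono (P.F₀ Q) (T.F₁ (adj.ηC Q) ∘ h) (T.F₁ (adj.ηC Q) ∘ k) (begin
        mate (P.F₀ Q) ∘ T.F₁ (adj.ηC Q) ∘ h   ≈⟨ mate-transpose Q h ⟩
        S.F₁ (P.F₁ h A.∘ ρ Q) ∘ adj.ηC _       ≈⟨ S.F-resp-≈ eq ⟩∘⟨refl ⟩
        S.F₁ (P.F₁ k A.∘ ρ Q) ∘ adj.ηC _       ≈⟨ mate-transpose Q k ⟨
        mate (P.F₀ Q) ∘ T.F₁ (adj.ηC Q) ∘ k   ∎))
    where open HomReasoning C

  P-∘-complex : ∀ {B} (c : Coalgebra) (f : B C.⇒ X c) →
                P.F₁ f A.∘ complex c A.≈ P.F₁ (γ c C.∘ f) A.∘ ρ (X c)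
  P-∘-complex c f = trans sym-assoc (sym P.homomorphism ⟩∘⟨refl)
    where open HomReasoning A

  complex-morphism : ∀ {b c} {f : X b C.⇒ X c} → IsCoalgebraMorphism b c f →
                     P.F₁ f A.∘ complex c A.≈ complex b A.∘ L.F₁ (P.F₁ f)
  complex-morphism {b} {c} {f} f-morphism = begin
    P.F₁ f ∘ complex c                  ≈⟨ P-∘-complex c f ⟩
    P.F₁ (γ c C.∘ f) ∘ ρ (X c)          ≈⟨ P.F-resp-≈ f-morphism ⟩∘⟨refl ⟩
    P.F₁ (T.F₁ f C.∘ γ b) ∘ ρ (X c)     ≈⟨ ρ-natural-∘ f (γ b) ⟩
    P.F₁ (γ b) ∘ ρ (X b) ∘ L.F₁ (P.F₁ f) ≈⟨ sym-assoc ⟩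
    complex b ∘ L.F₁ (P.F₁ f)           ∎
    where open HomReasoning A

  P-∘ρ-factor : ∀ {B Q D} (c : Coalgebra) (π : B C.⇒ X c) (i : X c C.⇒ Q)
                (p̄ : D A.⇒ P.F₀ (X c)) (u : P.F₀ Q A.⇒ D) → P.F₁ i A.≈ p̄ A.∘ u →
                P.F₁ (T.F₁ i C.∘ γ c C.∘ π) A.∘ ρ Q
                A.≈ (P.F₁ π A.∘ complex c A.∘ L.F₁ p̄) A.∘ L.F₁ u
  P-∘ρ-factor c π i p̄ u Pi≈p̄u = begin
    P.F₁ (T.F₁ i C.∘ γ c C.∘ π) ∘ ρ _              ≈⟨ ρ-natural-∘ i (γ c C.∘ π) ⟩
    P.F₁ (γ c C.∘ π) ∘ ρ (X c) ∘ L.F₁ (P.F₁ i)     ≈⟨ refl⟩∘⟨ refl⟩∘⟨ L.F-resp-≈ Pi≈p̄u ⟩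
    P.F₁ (γ c C.∘ π) ∘ ρ (X c) ∘ L.F₁ (p̄ ∘ u)      ≈⟨ refl⟩∘⟨ refl⟩∘⟨ L.homomorphism ⟩
    P.F₁ (γ c C.∘ π) ∘ ρ (X c) ∘ L.F₁ p̄ ∘ L.F₁ u   ≈⟨ sym-assoc ⟩
    (P.F₁ (γ c C.∘ π) ∘ ρ (X c)) ∘ L.F₁ p̄ ∘ L.F₁ u ≈⟨ sym (P-∘-complex c π) ⟩∘⟨refl ⟩
    (P.F₁ π ∘ complex c) ∘ L.F₁ p̄ ∘ L.F₁ u         ≈⟨ trans sym-assoc (assoc ⟩∘⟨refl) ⟩
    (P.F₁ π ∘ complex c ∘ L.F₁ p̄) ∘ L.F₁ u         ∎
    where open HomReasoning A

  module _ (c₁ c₂ : Coalgebra) where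

    rhoBisimulation⇒precocongruence :
      FaithfulContra P → RhoPointwiseEpic ⊎ (MatePointwiseMonic × PreservesMonos T) →
      (pbA : HasPullbacks A) (poC : HasPushouts C) →
      ∀ R → RhoBisimulation c₁ c₂ pbA R → Precocongruence c₁ c₂ poC R
    rhoBisimulation⇒precocongruence faithful hyp pbA poC R bisimulation =
      let (t , t-i₁ , t-i₂ , _) = proj₂ Q.isPushout (T.F₁ Q.i₁ C.∘ γ c₁) (T.F₁ Q.i₂ C.∘ γ c₂) cocone
      in t , t-i₁ , t-i₂
      where
        module R = Relation R
        module Q = Pushout (poC R.π₁ R.π₂)
        module D = Pullback (pbA (P.F₁ R.π₁) (P.F₁ R.π₂))
        open HomReasoning A

        transposed-cocone : (u : P.F₀ Q.Q ⇒ D.P) → D.p₁ ∘ u ≈ P.F₁ Q.i₁ → D.p₂ ∘ u ≈ P.F₁ Q.i₂ →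
                            P.F₁ (T.F₁ Q.i₁ C.∘ γ c₁ C.∘ R.π₁) ∘ ρ Q.Q
                            ≈ P.F₁ (T.F₁ Q.i₂ C.∘ γ c₂ C.∘ R.π₂) ∘ ρ Q.Q
        transposed-cocone u u₁ u₂ = begin
          P.F₁ (T.F₁ Q.i₁ C.∘ γ c₁ C.∘ R.π₁) ∘ ρ Q.Q
            ≈⟨ P-∘ρ-factor c₁ R.π₁ Q.i₁ D.p₁ u (sym u₁) ⟩
          (P.F₁ R.π₁ ∘ complex c₁ ∘ L.F₁ D.p₁) ∘ L.F₁ u
            ≈⟨ bisimulation ⟩∘⟨refl ⟩
          (P.F₁ R.π₂ ∘ complex c₂ ∘ L.F₁ D.p₂) ∘ L.F₁ u
            ≈⟨ P-∘ρ-factor c₂ R.π₂ Q.i₂ D.p₂ u (sym u₂) ⟨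
          P.F₁ (T.F₁ Q.i₂ C.∘ γ c₂ C.∘ R.π₂) ∘ ρ Q.Q
            ∎

        cocone : (T.F₁ Q.i₁ C.∘ γ c₁) C.∘ R.π₁ C.≈ (T.F₁ Q.i₂ C.∘ γ c₂) C.∘ R.π₂
        cocone =
          let (u , u₁ , u₂ , _) = proj₂ D.isPullback (P.F₁ Q.i₁) (P.F₁ Q.i₂)
                                        (contra-square P (proj₁ Q.isPushout))
          in C.trans C.assoc
               (C.trans (P-∘ρ-injective faithful hyp _ _ (transposed-cocone u u₁ u₂)) C.sym-assoc)

    tBisimulation⇒rhoBisimulation : (pbA : HasPullbacks A) →
      ∀ R → TBisimulation c₁ c₂ R → RhoBisimulation c₁ c₂ pbA R
    tBisimulation⇒rhoBisimulation pbA R (t , π₁-morphism , π₂-morphism) = begin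
      P.F₁ R.π₁ ∘ complex c₁ ∘ L.F₁ D.p₁   ≈⟨ through-b c₁ R.π₁ π₁-morphism D.p₁ ⟩
      complex b ∘ L.F₁ (P.F₁ R.π₁ ∘ D.p₁)  ≈⟨ refl⟩∘⟨ L.F-resp-≈ (proj₁ D.isPullback) ⟩
      complex b ∘ L.F₁ (P.F₁ R.π₂ ∘ D.p₂)  ≈⟨ through-b c₂ R.π₂ π₂-morphism D.p₂ ⟨
      P.F₁ R.π₂ ∘ complex c₂ ∘ L.F₁ D.p₂   ∎
      where
        module R = Relation R
        module D = Pullback (pbA (P.F₁ R.π₁) (P.F₁ R.π₂))
        open HomReasoning A

        b : Coalgebra
        b = record { X = R.B ; γ = t }

        through-b : ∀ {Dom} c (π : R.B C.⇒ X c) → IsCoalgebraMorphism b c π →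
                    (p̄ : Dom ⇒ P.F₀ (X c)) →
                    P.F₁ π ∘ complex c ∘ L.F₁ p̄ ≈ complex b ∘ L.F₁ (P.F₁ π ∘ p̄)
        through-b c π π-morphism p̄ = begin
          P.F₁ π ∘ complex c ∘ L.F₁ p̄          ≈⟨ sym-assoc ⟩
          (P.F₁ π ∘ complex c) ∘ L.F₁ p̄        ≈⟨ complex-morphism π-morphism ⟩∘⟨refl ⟩
          (complex b ∘ L.F₁ (P.F₁ π)) ∘ L.F₁ p̄ ≈⟨ assoc ⟩
          complex b ∘ L.F₁ (P.F₁ π) ∘ L.F₁ p̄   ≈⟨ refl⟩∘⟨ L.homomorphism ⟨
          complex b ∘ L.F₁ (P.F₁ π ∘ p̄)        ∎

    behaviouralEquivalence⇒tBisimulation : PreservesWeakPullbacks T →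
      ∀ R → BehaviouralEquivalence c₁ c₂ R → TBisimulation c₁ c₂ R
    behaviouralEquivalence⇒tBisimulation T-wpb R
                                         (d , f₁ , f₂ , f₁-morphism , f₂-morphism , pullback) =
      let (t , π₁-morphism , π₂-morphism) =
            proj₂ (T-wpb f₁ f₂ R.π₁ R.π₂ (pullback⇒weakPullback C pullback))
                  (γ c₁ ∘ R.π₁) (γ c₂ ∘ R.π₂) cone
      in t , sym π₁-morphism , sym π₂-morphism
      where
        module R = Relation R
        open HomReasoning C

        cone : T.F₁ f₁ ∘ γ c₁ ∘ R.π₁ ≈ T.F₁ f₂ ∘ γ c₂ ∘ R.π₂
        cone = begin
          T.F₁ f₁ ∘ γ c₁ ∘ R.π₁     ≈⟨ sym-assoc ⟩
          (T.F₁ f₁ ∘ γ c₁) ∘ R.π₁   ≈⟨ sym f₁-morphism ⟩∘⟨refl ⟩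
          (γ d ∘ f₁) ∘ R.π₁         ≈⟨ assoc ⟩
          γ d ∘ f₁ ∘ R.π₁           ≈⟨ refl⟩∘⟨ proj₁ pullback ⟩
          γ d ∘ f₂ ∘ R.π₂           ≈⟨ sym-assoc ⟩
          (γ d ∘ f₂) ∘ R.π₂         ≈⟨ f₂-morphism ⟩∘⟨refl ⟩
          (T.F₁ f₂ ∘ γ c₂) ∘ R.π₂   ≈⟨ assoc ⟩
          T.F₁ f₂ ∘ γ c₂ ∘ R.π₂     ∎

    precocongruence≼behaviouralEquivalence : (pbC : HasPullbacks C) (poC : HasPushouts C) →
      _≼_ C (Precocongruence c₁ c₂ poC) (BehaviouralEquivalence c₁ c₂)
    precocongruence≼behaviouralEquivalence pbC poC R (t , i₁-morphism , i₂-morphism) =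
      let (u , u₁ , u₂ , _) = proj₂ K.isPullback R.π₁ R.π₂ (proj₁ Q.isPushout)
      in kernel , (quotient , Q.i₁ , Q.i₂ , i₁-morphism , i₂-morphism , K.isPullback)
                , (u , u₁ , u₂)
      where
        module R = Relation R
        module Q = Pushout (poC R.π₁ R.π₂)
        module K = Pullback (pbC Q.i₁ Q.i₂)

        quotient : Coalgebra
        quotient = record { X = Q.Q ; γ = t }

        kernel : Rel₁₂ c₁ c₂
        kernel = record
          { span = record { B = K.P ; π₁ = K.p₁ ; π₂ = K.p₂ }
          ; jointlyMono = pullback-jointlyMono C K.isPullback
          }

proposition4p3 : ∀ {o ℓ e o' ℓ' e'}
    (C : Category o ℓ e) (A : Category o' ℓ' e')
    (P : ContraFunctor C A) (S : ContraFunctor A C)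
    (adj : DualAdjunction P S)
    (T : Endofunctor C) (L : Endofunctor A)
    (lg : Logic P T L)
    (pbC : HasPullbacks C) (pbA : HasPullbacks A) (poC : HasPushouts C) →
    FaithfulContra P →
    (Theory.RhoPointwiseEpic C A P S adj T L lg ⊎
      (Theory.MatePointwiseMonic C A P S adj T L lg × PreservesMonos T)) →
    (∀ (c₁ c₂ : Theory.Coalgebra C A P S adj T L lg)
       (R : Theory.Rel₁₂ C A P S adj T L lg c₁ c₂) →
       Theory.RhoBisimulation C A P S adj T L lg c₁ c₂ pbA R →
       Theory.Precocongruence C A P S adj T L lg c₁ c₂ poC R)
    ×
    (PreservesWeakPullbacks T →
     ∀ (c₁ c₂ : Theory.Coalgebra C A P S adj T L lg)
       (R : Theory.Rel₁₂ C A P S adj T L lg c₁ c₂) →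
       (IsJoin C (Theory.RhoBisimulation C A P S adj T L lg c₁ c₂ pbA) R
          ⇔ IsJoin C (Theory.TBisimulation C A P S adj T L lg c₁ c₂) R)
       ×
       (IsJoin C (Theory.RhoBisimulation C A P S adj T L lg c₁ c₂ pbA) R
          ⇔ IsJoin C (Theory.Precocongruence C A P S adj T L lg c₁ c₂ poC) R)
       ×
       (IsJoin C (Theory.RhoBisimulation C A P S adj T L lg c₁ c₂ pbA) R
          ⇔ IsJoin C (Theory.BehaviouralEquivalence C A P S adj T L lg c₁ c₂) R))
proposition4p3 C A P S adj T L lg pbC pbA poC faithful hyp =
  ρ⇒pre , λ T-wpb c₁ c₂ R →
    let ρ≼pre = ⊆⇒≼ C (ρ⇒pre c₁ c₂)
        pre≼beh = precocongruence≼behaviouralEquivalence c₁ c₂ pbC poC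
        beh≼T = ⊆⇒≼ C (behaviouralEquivalence⇒tBisimulation c₁ c₂ T-wpb)
        T≼ρ = ⊆⇒≼ C (tBisimulation⇒rhoBisimulation c₁ c₂ pbA)
    in IsJoin-resp-≼ C {R = R} (≼-trans C (≼-trans C ρ≼pre pre≼beh) beh≼T) T≼ρ
     , IsJoin-resp-≼ C {R = R} ρ≼pre (≼-trans C (≼-trans C pre≼beh beh≼T) T≼ρ)
     , IsJoin-resp-≼ C {R = R} (≼-trans C ρ≼pre pre≼beh) (≼-trans C beh≼T T≼ρ)
  where
    open Theory C A P S adj T L lg
    open Properties C A P S adj T L lg
    ρ⇒pre : ∀ c₁ c₂ R → RhoBisimulation c₁ c₂ pbA R → Precocongruence c₁ c₂ poC R
    ρ⇒pre c₁ c₂ = rhoBisimulation⇒precocongruence c₁ c₂ faithful hyp pbA poC
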